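{- Let $a,b$ be positive integers with $\min\{a,b\}=3$. Then $K_{a,b}^{1/2}$ is not locatable.
   Context: $K_{a,b}$ is the complete bipartite graph with parts of sizes $a$ and $b$. For a graph $G$ and positive integer $m$, $G^{1/m}$ denotes the graph obtained from $G$ by replacing each edge by a path of length $m$ through $m-1$ new vertices (so $K_{a,b}^{1/2}$ subdivides each edge once). The Robber Locating game on a finite connected graph: a robber occupies an (initially unknown) vertex. In each round the robber first either stays or moves to an adjacent vertex, and then the cop probes any vertex $v$ and is told the current distance from $v$ to the robber; there is no further restriction on the robber's moves. The cop wins if at some point she can determine the robber's current vertex uniquely. The robber is omniscient. A graph is locatable if the cop has a strategy guaranteed to win within a bounded number of rounds, equivalently one that wins against every robber behaviour. -}

module Defs where

open import Data.Nat using (ℕ; zero; suc; _≤_)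
open import Data.Fin using (Fin)
open import Data.List using (List; []; _∷_; _++_; [_]; length)
open import Data.Product using (Σ; _×_; _,_; ∃)
open import Data.Sum using (_⊎_)
open import Data.Unit using (⊤)
open import Relation.Binary.PropositionalEquality using (_≡_)

record Graph : Set₁ where
  field
    V   : Set
    Adj : V → V → Set
open Graph public

data WalkOfLength (G : Graph) : V G → V G → ℕ → Set where
  here : ∀ {u} → WalkOfLength G u u zero
  step : ∀ {u w v n} → Adj G u w → WalkOfLength G w v n → WalkOfLength G u v (suc n)

Dist : (G : Graph) → V G → V G → ℕ → Set
Dist G u v d = WalkOfLength G u v d × (∀ m → WalkOfLength G u v m → d ≤ m)

-- K_{a,b}^{1/2}: the complete bipartite graph K_{a,b} with every edge
-- subdivided once.  Vertices: the a left vertices, the b right vertices,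
-- and one subdivision vertex for each edge {left i, right j}.

data VtxK½ (a b : ℕ) : Set where
  left  : Fin a → VtxK½ a b
  right : Fin b → VtxK½ a b
  mid   : Fin a → Fin b → VtxK½ a b

data AdjK½ {a b : ℕ} : VtxK½ a b → VtxK½ a b → Set where
  left-mid  : ∀ i j → AdjK½ (left i) (mid i j)
  mid-left  : ∀ i j → AdjK½ (mid i j) (left i)
  right-mid : ∀ i j → AdjK½ (right j) (mid i j)
  mid-right : ∀ i j → AdjK½ (mid i j) (right j)

K½ : ℕ → ℕ → Graph
K½ a b = record { V = VtxK½ a b ; Adj = AdjK½ }

-- Robber behaviour: a sequence r 0, r 1, r 2, ... where r 0 is the initial
-- vertex and r i is the robber's vertex in round i (i ≥ 1); in each round he
-- stays or moves to an adjacent vertex.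

RobberWalk : (G : Graph) → (ℕ → V G) → Set
RobberWalk G r = ∀ i → (r (suc i) ≡ r i) ⊎ Adj G (r i) (r (suc i))

-- A (deterministic) cop strategy: the vertex to probe, given the list of
-- answers (distances) received in previous rounds, in chronological order.
CopStrategy : Graph → Set
CopStrategy G = List ℕ → V G

-- Consistent G σ r hist ds : starting after the rounds recorded in hist,
-- the answers ds are exactly those the cop (playing σ) receives in the
-- following rounds against robber walk r.
Consistent : (G : Graph) → CopStrategy G → (ℕ → V G) → List ℕ → List ℕ → Set
Consistent G σ r hist [] = ⊤
Consistent G σ r hist (d ∷ ds) =
  Dist G (σ hist) (r (suc (length hist))) d × Consistent G σ r (hist ++ [ d ]) ds

-- The cop playing σ against robber walk r knows the robber's position after
-- round k: with the answers ds obtained in rounds 1..k, every robber walk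
-- yielding the same answers is at the same vertex in round k.
WinsAt : (G : Graph) → CopStrategy G → (ℕ → V G) → ℕ → Set
WinsAt G σ r k =
  Σ (List ℕ) λ ds → length ds ≡ k × Consistent G σ r [] ds ×
    (∀ r' → RobberWalk G r' → Consistent G σ r' [] ds → r' k ≡ r k)

Locatable : Graph → Set
Locatable G = Σ (CopStrategy G) λ σ → Σ ℕ λ N →
  ∀ r → RobberWalk G r → Σ ℕ λ k → (1 ≤ k × k ≤ N) × WinsAt G σ r k

-- The robber keeps three "ghosts": robber positions, at least two of them
-- distinct, that every probe so far answers identically and that can each
-- continue as a legal walk.  In K_{a,b}^{1/2} with a, b ≥ 3 such a family
-- survives every probe: ghosts on two branch vertices of one side fan out
-- into three subdivision vertices whose coordinates on the other side are
-- pairwise distinct, and these retreat to two branch vertices of that other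
-- side avoiding the probed coordinate.  Two distinct ghosts in the round the
-- cop claims victory contradict the uniqueness of her answer.

module Submission where

open import Defs
open import Data.Nat using (ℕ; zero; suc; _+_; _≤_; _≤′_; ≤′-refl; ≤′-step; _⊓_; z≤n; s≤s; pred)
open import Data.Nat.Properties using (≤-antisym; ≤-refl; ≤-trans; ≤-reflexive; m≤m+n; m≤n+m; +-monoˡ-≤; +-monoʳ-≤; +-comm; +-assoc; +-suc; m+n≤o⇒m≤o; ≤⇒≤′; m⊓n≤m; m⊓n≤n)
open import Data.Fin using (Fin; zero; suc; _↑ˡ_)
open import Data.Fin.Patterns using (0F; 1F; 2F)
open import Data.Fin.Properties using (_≟_)
open import Data.List using (List; []; _∷_; _++_; [_]; length)
open import Data.List.Properties using (length-++; ++-identityʳ; ++-assoc)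
open import Data.Product using (Σ; _×_; _,_; proj₁; proj₂)
open import Data.Sum using (_⊎_; inj₁; inj₂)
open import Data.Unit using (tt)
open import Data.Empty using (⊥-elim)
open import Function using (_∘_; id)
open import Relation.Binary.Definitions using (DecidableEquality)
open import Relation.Binary.PropositionalEquality using (_≡_; _≢_; refl; sym; trans; cong; cong₂; subst; ≢-sym; module ≡-Reasoning)
open import Relation.Nullary using (¬_; yes; no)

Dist-unique : ∀ {G : Graph} {u v d d′} → Dist G u v d → Dist G u v d′ → d ≡ d′
Dist-unique (walk , shortest) (walk′ , shortest′) = ≤-antisym (shortest _ walk′) (shortest′ _ walk)

module _ {G : Graph} (d : V G → V G → ℕ) (d-refl : ∀ v → d v v ≡ 0)
         (d-adj : ∀ {u w} → Adj G u w → ∀ v → d u v ≤ suc (d w v)) where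

  ≤-walk-length : ∀ {u v m} → WalkOfLength G u v m → d u v ≤ m
  ≤-walk-length {u} here         = ≤-reflexive (d-refl u)
  ≤-walk-length (step adj walk) = ≤-trans (d-adj adj _) (s≤s (≤-walk-length walk))

  Dist-intro : (∀ u v → WalkOfLength G u v (d u v)) → ∀ u v → Dist G u v (d u v)
  Dist-intro walk u v = walk u v , λ _ → ≤-walk-length

-- The evasion argument

Step : (G : Graph) → V G → V G → Set
Step G u v = v ≡ u ⊎ Adj G u v

module _ {G : Graph} where

  extend : (ℕ → V G) → ℕ → V G → ℕ → V G
  extend w zero    t zero    = w zero
  extend w zero    t (suc i) = t
  extend w (suc k) t zero    = w zero
  extend w (suc k) t (suc i) = extend (w ∘ suc) k t i

  extend-≤ : ∀ w {k} t {i} → i ≤ k → extend w k t i ≡ w i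
  extend-≤ w {zero}  t z≤n     = refl
  extend-≤ w {suc k} t z≤n     = refl
  extend-≤ w {suc k} t (s≤s p) = extend-≤ (w ∘ suc) t p

  extend-suc : ∀ w k t → extend w k t (suc k) ≡ t
  extend-suc w zero    t = refl
  extend-suc w (suc k) t = extend-suc (w ∘ suc) k t

  extend-walk : ∀ {w} k {t} → RobberWalk G w → Step G (w k) t → RobberWalk G (extend w k t)
  extend-walk zero          walk last zero    = last
  extend-walk zero          walk last (suc i) = inj₁ refl
  extend-walk (suc zero)    walk last zero    = walk zero
  extend-walk (suc (suc k)) walk last zero    = walk zero
  extend-walk (suc k)       walk last (suc i) = extend-walk k (walk ∘ suc) last i

module _ {G : Graph} (σ : CopStrategy G) where

  consistent-agree : ∀ {r r′} h ds {k} → length h + length ds ≤ k → (∀ i → i ≤ k → r i ≡ r′ i) →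
                     Consistent G σ r h ds → Consistent G σ r′ h ds
  consistent-agree h []       _     _     _       = tt
  consistent-agree h (d ∷ ds) bound agree (D , C) =
    subst (λ u → Dist G (σ h) u d) (agree _ now) D , consistent-agree (h ++ [ d ]) ds later agree C
    where
      now : suc (length h) ≤ _
      now = m+n≤o⇒m≤o (suc (length h)) (≤-trans (≤-reflexive (sym (+-suc (length h) (length ds)))) bound)
      later : length (h ++ [ d ]) + length ds ≤ _
      later = ≤-trans (≤-reflexive (trans (cong (_+ length ds) (length-++ h)) (+-assoc (length h) 1 (length ds)))) bound

  consistent-∷ʳ : ∀ {r} h ds {d} → Consistent G σ r h ds →
                  Dist G (σ (h ++ ds)) (r (suc (length (h ++ ds)))) d → Consistent G σ r h (ds ++ [ d ])
  consistent-∷ʳ {r} h [] {d} _ D = subst (λ h′ → Dist G (σ h′) (r (suc (length h′))) d) (++-identityʳ h) D , tt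
  consistent-∷ʳ {r} h (x ∷ ds) {d} (D₀ , C) D =
    D₀ , consistent-∷ʳ (h ++ [ x ]) ds C (subst (λ h′ → Dist G (σ h′) (r (suc (length h′))) d) (sym (++-assoc h [ x ] ds)) D)

  consistent-++⁻ˡ : ∀ {r} h xs ys → Consistent G σ r h (xs ++ ys) → Consistent G σ r h xs
  consistent-++⁻ˡ h []       ys _       = tt
  consistent-++⁻ˡ h (x ∷ xs) ys (D , C) = D , consistent-++⁻ˡ (h ++ [ x ]) xs ys C

  consistent-unique : ∀ {r} h xs ys → length xs ≡ length ys →
                      Consistent G σ r h xs → Consistent G σ r h ys → xs ≡ ys
  consistent-unique h []       []       _   _       _         = refl
  consistent-unique h (x ∷ xs) (y ∷ ys) len (D , C) (D′ , C′) with Dist-unique {G} D D′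
  ... | refl = cong (x ∷_) (consistent-unique (h ++ [ x ]) xs ys (cong pred len) C C′)

module _ (G : Graph) {State Ghost : Set} (position : State → Ghost → V G) where

  record Response (s : State) (v : V G) : Set where
    field
      next        : State
      answer      : ℕ
      answer-dist : ∀ g → Dist G v (position next g) answer
      follows     : ∀ g → Σ Ghost λ g′ → Step G (position s g′) (position next g)

  module _ (g₀ g₁ : Ghost) (apart : ∀ s → position s g₀ ≢ position s g₁)
           (start : State) (respond : ∀ s v → Response s v) where

    module Play (σ : CopStrategy G) where

      record Stage (n : ℕ) : Set where
        field
          history         : List ℕ
          length-history  : length history ≡ n
          state           : State
          walk            : Ghost → ℕ → V G
          walk-valid      : ∀ g → RobberWalk G (walk g)
          walk-consistent : ∀ g → Consistent G σ (walk g) [] history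
          walk-now        : ∀ g → walk g n ≡ position state g

      advance : ∀ {n} → Stage n → Stage (suc n)
      advance {n} S = record
        { history         = history ++ [ answer ]
        ; length-history  = trans (length-++ history) (trans (+-comm _ 1) (cong suc length-history))
        ; state           = next
        ; walk            = walk′
        ; walk-valid      = λ g → extend-walk {G} n (walk-valid (source g)) (moves g)
        ; walk-consistent = λ g → consistent-∷ʳ σ [] history (keeps-history g) (gives-answer g)
        ; walk-now        = λ g → extend-suc (walk (source g)) n (position next g)
        }
        where
          open Stage S
          open Response (respond state (σ history))
          source : Ghost → Ghost
          source g = proj₁ (follows g)
          walk′ : Ghost → ℕ → V G
          walk′ g = extend (walk (source g)) n (position next g)
          moves : ∀ g → Step G (walk (source g) n) (position next g)
          moves g = subst (λ u → Step G u (position next g)) (sym (walk-now (source g))) (proj₂ (follows g))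
          keeps-history : ∀ g → Consistent G σ (walk′ g) [] history
          keeps-history g = consistent-agree σ [] history (≤-reflexive length-history)
                              (λ _ i≤n → sym (extend-≤ _ _ i≤n)) (walk-consistent (source g))
          arrives : ∀ g → walk′ g (suc (length history)) ≡ position next g
          arrives g = trans (cong (walk′ g ∘ suc) length-history) (extend-suc (walk (source g)) n (position next g))
          gives-answer : ∀ g → Dist G (σ history) (walk′ g (suc (length history))) answer
          gives-answer g = subst (λ u → Dist G (σ history) u answer) (sym (arrives g)) (answer-dist g)

      history-advance : ∀ {n} (S : Stage n) → Σ ℕ λ d → Stage.history (advance S) ≡ Stage.history S ++ [ d ]
      history-advance S = _ , refl

      stage : ∀ n → Stage n
      stage zero = record
        { history = [] ; length-history = refl ; state = start ; walk = λ g _ → position start g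
        ; walk-valid = λ _ _ → inj₁ refl ; walk-consistent = λ _ → tt ; walk-now = λ _ → refl }
      stage (suc n) = advance (stage n)

      history-prefix : ∀ {k n} → k ≤′ n → Σ (List ℕ) λ rest → Stage.history (stage n) ≡ Stage.history (stage k) ++ rest
      history-prefix ≤′-refl = [] , sym (++-identityʳ _)
      history-prefix {n = suc n} (≤′-step k≤n) with history-prefix k≤n | history-advance (stage n)
      ... | rest , eq | d , eq′ = rest ++ [ d ] , trans eq′ (trans (cong (_++ [ d ]) eq) (++-assoc _ rest [ d ]))

      consistent-earlier : ∀ {k n} → k ≤ n → ∀ g → Consistent G σ (Stage.walk (stage n) g) [] (Stage.history (stage k))
      consistent-earlier {n = n} k≤n g with history-prefix (≤⇒≤′ k≤n)
      ... | rest , eq = consistent-++⁻ˡ σ [] _ rest (subst (Consistent G σ _ []) eq (Stage.walk-consistent (stage n) g))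

      not-caught : ∀ {N} k → k ≤ N → ¬ WinsAt G σ (Stage.walk (stage N) g₀) k
      not-caught {N} k k≤N (ds , length-ds , consistent-ds , determined) = apart state positions-agree
        where
          open Stage (stage k)
          open ≡-Reasoning
          robber = Stage.walk (stage N) g₀
          ds≡history : ds ≡ history
          ds≡history = consistent-unique σ [] ds history (trans length-ds (sym length-history))
                         consistent-ds (consistent-earlier k≤N g₀)
          meets-robber : ∀ g → walk g k ≡ robber k
          meets-robber g = determined (walk g) (walk-valid g)
                             (subst (Consistent G σ (walk g) []) (sym ds≡history) (walk-consistent g))
          positions-agree : position state g₀ ≡ position state g₁
          positions-agree = begin
            position state g₀  ≡⟨ sym (walk-now g₀) ⟩
            walk g₀ k          ≡⟨ meets-robber g₀ ⟩
            robber k           ≡⟨ sym (meets-robber g₁) ⟩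
            walk g₁ k          ≡⟨ walk-now g₁ ⟩
            position state g₁  ∎

    evasion⇒¬locatable : ¬ Locatable G
    evasion⇒¬locatable (σ , N , wins) =
      let k , (_ , k≤N) , won = wins (Stage.walk (stage N) g₀) (Stage.walk-valid (stage N) g₀)
      in  not-caught k k≤N won
      where open Play σ

-- Distances in K_{a,b}^{1/2}

gap : ∀ {n} → Fin n → Fin n → ℕ
gap i j with i ≟ j
... | yes _ = 0
... | no  _ = 2

gap-refl : ∀ {n} (i : Fin n) → gap i i ≡ 0
gap-refl i with i ≟ i
... | yes _   = refl
... | no i≢i = ⊥-elim (i≢i refl)

gap-≢ : ∀ {n} {i j : Fin n} → i ≢ j → gap i j ≡ 2
gap-≢ {i = i} {j} i≢j with i ≟ j
... | yes i≡j = ⊥-elim (i≢j i≡j)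
... | no  _   = refl

gap+gap-≢ : ∀ {n} {i j : Fin n} → i ≢ j → gap i j + gap i j ≡ 4
gap+gap-≢ i≢j = cong (λ g → g + g) (gap-≢ i≢j)

gap≤2 : ∀ {n} (i j : Fin n) → gap i j ≤ 2
gap≤2 i j with i ≟ j
... | yes _ = z≤n
... | no  _ = ≤-refl

module _ {a b : ℕ} where

  dist : VtxK½ (suc a) (suc b) → VtxK½ (suc a) (suc b) → ℕ
  dist (left i)  (left i′)   = gap i i′ + gap i i′
  dist (left i)  (right j)   = 2
  dist (left i)  (mid i′ j)  = suc (gap i i′)
  dist (right j) (left i)    = 2
  dist (right j) (right j′)  = gap j j′ + gap j j′
  dist (right j) (mid i j′)  = suc (gap j j′)
  dist (mid i j) (left i′)   = suc (gap i i′)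
  dist (mid i j) (right j′)  = suc (gap j j′)
  dist (mid i j) (mid i′ j′) = gap i i′ + gap j j′

  private
    G = K½ (suc a) (suc b)

  dist-refl : ∀ u → dist u u ≡ 0
  dist-refl (left i)  = cong₂ _+_ (gap-refl i) (gap-refl i)
  dist-refl (right j) = cong₂ _+_ (gap-refl j) (gap-refl j)
  dist-refl (mid i j) = cong₂ _+_ (gap-refl i) (gap-refl j)

  dist-adj : ∀ {u w} → AdjK½ u w → ∀ v → dist u v ≤ suc (dist w v)
  dist-adj (left-mid i j)  (left i′)    = +-monoˡ-≤ (gap i i′) (gap≤2 i i′)
  dist-adj (left-mid i j)  (right j′)   = s≤s (s≤s z≤n)
  dist-adj (left-mid i j)  (mid i′ j′)  = s≤s (m≤m+n (gap i i′) (gap j j′))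
  dist-adj (mid-left i j)  (left i′)    = s≤s (m≤m+n (gap i i′) (gap i i′))
  dist-adj (mid-left i j)  (right j′)   = s≤s (gap≤2 j j′)
  dist-adj (mid-left i j)  (mid i′ j′)  = ≤-trans (+-monoʳ-≤ (gap i i′) (gap≤2 j j′)) (≤-reflexive (+-comm (gap i i′) 2))
  dist-adj (right-mid i j) (left i′)    = s≤s (s≤s z≤n)
  dist-adj (right-mid i j) (right j′)   = +-monoˡ-≤ (gap j j′) (gap≤2 j j′)
  dist-adj (right-mid i j) (mid i′ j′)  = s≤s (m≤n+m (gap j j′) (gap i i′))
  dist-adj (mid-right i j) (left i′)    = s≤s (gap≤2 i i′)
  dist-adj (mid-right i j) (right j′)   = s≤s (m≤m+n (gap j j′) (gap j j′))
  dist-adj (mid-right i j) (mid i′ j′)  = +-monoˡ-≤ (gap j j′) (gap≤2 i i′)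

  shortest-walk : ∀ u v → WalkOfLength G u v (dist u v)
  shortest-walk (left i) (left i′) with i ≟ i′
  ... | yes refl = here
  ... | no _     = step (left-mid i 0F) (step (mid-right i 0F) (step (right-mid i′ 0F) (step (mid-left i′ 0F) here)))
  shortest-walk (left i) (right j) = step (left-mid i j) (step (mid-right i j) here)
  shortest-walk (left i) (mid i′ j) with i ≟ i′
  ... | yes refl = step (left-mid i j) here
  ... | no _     = step (left-mid i j) (step (mid-right i j) (step (right-mid i′ j) here))
  shortest-walk (right j) (left i) = step (right-mid i j) (step (mid-left i j) here)
  shortest-walk (right j) (right j′) with j ≟ j′
  ... | yes refl = here
  ... | no _     = step (right-mid 0F j) (step (mid-left 0F j) (step (left-mid 0F j′) (step (mid-right 0F j′) here)))
  shortest-walk (right j) (mid i j′) with j ≟ j′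
  ... | yes refl = step (right-mid i j) here
  ... | no _     = step (right-mid i j) (step (mid-left i j) (step (left-mid i j′) here))
  shortest-walk (mid i j) (left i′) with i ≟ i′
  ... | yes refl = step (mid-left i j) here
  ... | no _     = step (mid-right i j) (step (right-mid i′ j) (step (mid-left i′ j) here))
  shortest-walk (mid i j) (right j′) with j ≟ j′
  ... | yes refl = step (mid-right i j) here
  ... | no _     = step (mid-left i j) (step (left-mid i j′) (step (mid-right i j′) here))
  shortest-walk (mid i j) (mid i′ j′) with i ≟ i′ | j ≟ j′
  ... | yes refl | yes refl = here
  ... | yes refl | no _     = step (mid-left i j) (step (left-mid i j′) here)
  ... | no _     | yes refl = step (mid-right i j) (step (right-mid i′ j) here)
  ... | no _     | no _     = step (mid-left i j) (step (left-mid i j′) (step (mid-right i j′) (step (right-mid i′ j′) here)))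

  dist-correct : ∀ u v → Dist G u v (dist u v)
  dist-correct = Dist-intro dist dist-refl dist-adj shortest-walk

-- The robber's strategy in K_{a,b}^{1/2}

Distinct3 : ∀ {X : Set} → (Fin 3 → X) → Set
Distinct3 x = x 0F ≢ x 1F × x 0F ≢ x 2F × x 1F ≢ x 2F

triple : ∀ {X : Set} → X → X → X → Fin 3 → X
triple p q r 0F = p
triple p q r 1F = q
triple p q r 2F = r

∀-Fin3 : ∀ {P : Fin 3 → Set} → P 0F → P 1F → P 2F → ∀ c → P c
∀-Fin3 p q r 0F = p
∀-Fin3 p q r 1F = q
∀-Fin3 p q r 2F = r

↑ˡ-distinct : ∀ n → Distinct3 (_↑ˡ n)
↑ˡ-distinct n = (λ ()) , (λ ()) , (λ ())

two-avoiding : ∀ {X : Set} → DecidableEquality X → (x : Fin 3 → X) → Distinct3 x → (k : X) →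
               Σ (Fin 3) λ c → Σ (Fin 3) λ c′ → x c ≢ x c′ × x c ≢ k × x c′ ≢ k
two-avoiding _≟X_ x (x₀≢x₁ , x₀≢x₂ , x₁≢x₂) k with x 0F ≟X k | x 1F ≟X k
... | yes refl | _        = 1F , 2F , x₁≢x₂ , ≢-sym x₀≢x₁ , ≢-sym x₀≢x₂
... | no x₀≢k  | yes refl = 0F , 2F , x₀≢x₂ , x₀≢k , ≢-sym x₁≢x₂
... | no x₀≢k  | no x₁≢k  = 0F , 1F , x₀≢x₁ , x₀≢k , x₁≢k

module Evasion (a b : ℕ) where

  private
    A = 3 + a
    B = 3 + b
    G = K½ A B

  -- A triple is named after the side it retreats to next.
  data Configuration : Set where
    pairˡ   : (x x′ : Fin A) → x ≢ x′ → Configuration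
    pairʳ   : (y y′ : Fin B) → y ≢ y′ → Configuration
    tripleˡ : (x : Fin 3 → Fin A) (y : Fin 3 → Fin B) → Distinct3 x → Configuration
    tripleʳ : (x : Fin 3 → Fin A) (y : Fin 3 → Fin B) → Distinct3 y → Configuration

  ghost : Configuration → Fin 3 → VtxK½ A B
  ghost (pairˡ x x′ _)  c = left (triple x x′ x c)
  ghost (pairʳ y y′ _)  c = right (triple y y′ y c)
  ghost (tripleˡ x y _) c = mid (x c) (y c)
  ghost (tripleʳ x y _) c = mid (x c) (y c)

  ghosts-apart : ∀ s → ghost s 0F ≢ ghost s 1F
  ghosts-apart (pairˡ x x′ x≢x′)        refl = x≢x′ refl
  ghosts-apart (pairʳ y y′ y≢y′)        refl = y≢y′ refl
  ghosts-apart (tripleˡ x y (x₀≢x₁ , _)) eq  = x₀≢x₁ (cong first eq)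
    where first : VtxK½ A B → Fin A
          first (mid i _) = i
          first _         = x 0F
  ghosts-apart (tripleʳ x y (y₀≢y₁ , _)) eq  = y₀≢y₁ (cong second eq)
    where second : VtxK½ A B → Fin B
          second (mid _ j) = j
          second _         = y 0F

  respond-by : ∀ {s v} s′ d → (∀ c → dist v (ghost s′ c) ≡ d) →
               (source : Fin 3 → Fin 3) → (∀ c → Step G (ghost s (source c)) (ghost s′ c)) → Response G ghost s v
  respond-by s′ d at source moves = record
    { next = s′ ; answer = d ; answer-dist = λ c → subst (Dist G _ _) (at c) (dist-correct _ _)
    ; follows = λ c → source c , moves c }

  stay : ∀ {s v} d → (∀ c → dist v (ghost s c) ≡ d) → Response G ghost s v
  stay d at = respond-by _ d at id (λ _ → inj₁ refl)

  moves-from : ∀ {s g u w} → ghost s g ≡ u → AdjK½ u w → Step G (ghost s g) w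
  moves-from {w = w} at adj = subst (λ u → Step G u w) (sym at) (inj₂ adj)

  enter-column : ∀ {s} y g → ghost s g ≡ right y → Response G ghost s (right y)
  enter-column y g at =
    respond-by (tripleˡ (_↑ˡ a) (λ _ → y) (↑ˡ-distinct a)) 1 (λ _ → cong suc (gap-refl y))
      (λ _ → g) (λ c → moves-from at (right-mid (c ↑ˡ a) y))

  enter-row : ∀ {s} x g → ghost s g ≡ left x → Response G ghost s (left x)
  enter-row x g at =
    respond-by (tripleʳ (λ _ → x) (_↑ˡ b) (↑ˡ-distinct b)) 1 (λ _ → cong suc (gap-refl x))
      (λ _ → g) (λ c → moves-from at (left-mid x (c ↑ˡ b)))

  fan-out-column : ∀ {s} x {y y′} → y ≢ y′ → (g g′ : Fin 3) → ghost s g ≡ right y → ghost s g′ ≡ right y′ →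
                   Response G ghost s (mid x y)
  fan-out-column x {y} {y′} y≢y′ g g′ at at′ with two-avoiding _≟_ (_↑ˡ a) (↑ˡ-distinct a) x
  ... | c , c′ , x₁≢x₂ , x₁≢x , x₂≢x =
    respond-by (tripleˡ (triple (c ↑ˡ a) (c′ ↑ˡ a) x) (triple y y y′) (x₁≢x₂ , x₁≢x , x₂≢x)) 2
      (∀-Fin3 (cong₂ _+_ (gap-≢ (≢-sym x₁≢x)) (gap-refl y))
              (cong₂ _+_ (gap-≢ (≢-sym x₂≢x)) (gap-refl y))
              (cong₂ _+_ (gap-refl x) (gap-≢ y≢y′)))
      (triple g g g′)
      (∀-Fin3 (moves-from at (right-mid _ y)) (moves-from at (right-mid _ y)) (moves-from at′ (right-mid x y′)))

  fan-out-row : ∀ {s} {x x′} y → x ≢ x′ → (g g′ : Fin 3) → ghost s g ≡ left x → ghost s g′ ≡ left x′ →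
                Response G ghost s (mid x y)
  fan-out-row {x = x} {x′} y x≢x′ g g′ at at′ with two-avoiding _≟_ (_↑ˡ b) (↑ˡ-distinct b) y
  ... | c , c′ , y₁≢y₂ , y₁≢y , y₂≢y =
    respond-by (tripleʳ (triple x x x′) (triple (c ↑ˡ b) (c′ ↑ˡ b) y) (y₁≢y₂ , y₁≢y , y₂≢y)) 2
      (∀-Fin3 (cong₂ _+_ (gap-refl x) (gap-≢ (≢-sym y₁≢y)))
              (cong₂ _+_ (gap-refl x) (gap-≢ (≢-sym y₂≢y)))
              (cong₂ _+_ (gap-≢ x≢x′) (gap-refl y)))
      (triple g g g′)
      (∀-Fin3 (moves-from at (left-mid x _)) (moves-from at (left-mid x _)) (moves-from at′ (left-mid x′ y)))

  retreat-left : ∀ {x y dx v} k d → (∀ i → i ≢ k → dist v (left i) ≡ d) → Response G ghost (tripleˡ x y dx) v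
  retreat-left {x} {y} {dx} k d at with two-avoiding _≟_ x dx k
  ... | c , c′ , x≢x′ , c≢k , c′≢k =
    respond-by (pairˡ (x c) (x c′) x≢x′) d (∀-Fin3 (at _ c≢k) (at _ c′≢k) (at _ c≢k))
      (triple c c′ c) (∀-Fin3 (inj₂ (mid-left _ _)) (inj₂ (mid-left _ _)) (inj₂ (mid-left _ _)))

  retreat-right : ∀ {x y dy v} k d → (∀ j → j ≢ k → dist v (right j) ≡ d) → Response G ghost (tripleʳ x y dy) v
  retreat-right {x} {y} {dy} k d at with two-avoiding _≟_ y dy k
  ... | c , c′ , y≢y′ , c≢k , c′≢k =
    respond-by (pairʳ (y c) (y c′) y≢y′) d (∀-Fin3 (at _ c≢k) (at _ c′≢k) (at _ c≢k))
      (triple c c′ c) (∀-Fin3 (inj₂ (mid-right _ _)) (inj₂ (mid-right _ _)) (inj₂ (mid-right _ _)))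

  respond : ∀ s v → Response G ghost s v
  respond (pairʳ y y′ y≢y′) (left i) = stay 2 (λ _ → refl)
  respond (pairʳ y y′ y≢y′) (right k) with k ≟ y | k ≟ y′
  ... | yes refl | _        = enter-column k 0F refl
  ... | no _     | yes refl = enter-column k 1F refl
  ... | no k≢y   | no k≢y′  = stay 4 (∀-Fin3 (gap+gap-≢ k≢y) (gap+gap-≢ k≢y′) (gap+gap-≢ k≢y))
  respond (pairʳ y y′ y≢y′) (mid x k) with k ≟ y | k ≟ y′
  ... | yes refl | _        = fan-out-column x y≢y′ 0F 1F refl refl
  ... | no _     | yes refl = fan-out-column x (≢-sym y≢y′) 1F 0F refl refl
  ... | no k≢y   | no k≢y′  = stay 3 (∀-Fin3 (cong suc (gap-≢ k≢y)) (cong suc (gap-≢ k≢y′)) (cong suc (gap-≢ k≢y)))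
  respond (pairˡ x x′ x≢x′) (right j) = stay 2 (λ _ → refl)
  respond (pairˡ x x′ x≢x′) (left k) with k ≟ x | k ≟ x′
  ... | yes refl | _        = enter-row k 0F refl
  ... | no _     | yes refl = enter-row k 1F refl
  ... | no k≢x   | no k≢x′  = stay 4 (∀-Fin3 (gap+gap-≢ k≢x) (gap+gap-≢ k≢x′) (gap+gap-≢ k≢x))
  respond (pairˡ x x′ x≢x′) (mid k y) with k ≟ x | k ≟ x′
  ... | yes refl | _        = fan-out-row y x≢x′ 0F 1F refl refl
  ... | no _     | yes refl = fan-out-row y (≢-sym x≢x′) 1F 0F refl refl
  ... | no k≢x   | no k≢x′  = stay 3 (∀-Fin3 (cong suc (gap-≢ k≢x)) (cong suc (gap-≢ k≢x′)) (cong suc (gap-≢ k≢x)))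
  respond (tripleˡ x y dx) (left k)   = retreat-left k 4 (λ _ i≢k → gap+gap-≢ (≢-sym i≢k))
  respond (tripleˡ x y dx) (right j)  = retreat-left 0F 2 (λ _ _ → refl)  -- any coordinate may be avoided
  respond (tripleˡ x y dx) (mid k j)  = retreat-left k 3 (λ _ i≢k → cong suc (gap-≢ (≢-sym i≢k)))
  respond (tripleʳ x y dy) (left i)   = retreat-right 0F 2 (λ _ _ → refl)
  respond (tripleʳ x y dy) (right k)  = retreat-right k 4 (λ _ j≢k → gap+gap-≢ (≢-sym j≢k))
  respond (tripleʳ x y dy) (mid i k)  = retreat-right k 3 (λ _ j≢k → cong suc (gap-≢ (≢-sym j≢k)))

  K½-¬locatable : ¬ Locatable G
  K½-¬locatable = evasion⇒¬locatable G ghost 0F 1F ghosts-apart (pairʳ 0F 1F (λ ())) respond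

¬locatable-≥3 : ∀ {a b} → 3 ≤ a → 3 ≤ b → ¬ Locatable (K½ a b)
¬locatable-≥3 {suc (suc (suc a))} {suc (suc (suc b))} (s≤s (s≤s (s≤s z≤n))) (s≤s (s≤s (s≤s z≤n))) =
  Evasion.K½-¬locatable a b

mainTheorem6 : (a b : ℕ) → 1 ≤ a → 1 ≤ b → a ⊓ b ≡ 3 → ¬ Locatable (K½ a b)
mainTheorem6 a b _ _ a⊓b≡3 = ¬locatable-≥3 (subst (_≤ a) a⊓b≡3 (m⊓n≤m a b)) (subst (_≤ b) a⊓b≡3 (m⊓n≤n a b))
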